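{- Let $H$ be a simple, connected, $k$-uniform hypergraph with $n$ vertices and more than one edge. Then exactly $n-k$ of the intervals $P_1,\ldots,P_n$ of the burning distribution are empty, and exactly $n-k$ of the intervals $Q_1,\ldots,Q_n$ of the lazy burning distribution are empty.
   Context: A hypergraph $H=(V(H),E(H))$ has a finite nonempty vertex set and a finite collection $E(H)$ of subsets of $V(H)$ called edges; it is $k$-uniform if every edge has exactly $k$ vertices, simple if no edge is repeated and no edge has at most one vertex, and connected if any two vertices are joined by a path of vertices consecutive ones of which lie in a common edge. For a proportion $p\in(0,1)$, the proportion-based propagation rule is: if at the end of a round at least $\lceil p|e|\rceil$ vertices of an edge $e$ are on fire, then in the next round all vertices of $e$ catch fire; burned vertices stay burned. Burning game: let $F_0=\emptyset$ and $F_r$ be the set of burned vertices at the end of round $r$. In each round $r\geq 1$, simultaneously, vertices catch fire by propagation from $F_{r-1}$ (no propagation in round 1), and a player chooses a vertex $u_r\notin F_{r-1}$ (a source) and sets it on fire. A burning sequence is a sequence $(u_1,\ldots,u_k)$ of such sources after which every vertex is on fire at the end of round $k$; $b_p(H)$ is the minimum length of a burning sequence. Lazy game: $S\subseteq V(H)$ is a lazy burning set if, setting all of $S$ on fire at once and then repeatedly applying the propagation rule, every vertex eventually catches fire; $b_{L,p}(H)$ is the minimum size of a lazy burning set. The burning distribution is the partition of $(0,1)$ into the sets $P_j=\{p\in(0,1): b_p(H)=j\}$, and the lazy burning distribution into $Q_j=\{p\in(0,1): b_{L,p}(H)=j\}$, $j=1,\ldots,n$.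
   Formalization: The proportion p ranges over the rationals strictly between 0 and 1, so the intervals $P_j$ and $Q_j$ consist of rational proportions. -}

module Defs where

open import Data.Nat as ℕ using (ℕ; zero; suc; _≤_)
open import Data.Integer as ℤ using (ℤ; +_)
open import Data.Rational as ℚ using (ℚ; 0ℚ; 1ℚ)
open import Data.Bool using (Bool; true; false; if_then_else_)
open import Data.Fin using (Fin; toℕ)
open import Data.Fin.Subset using (Subset; ⊥; ⊤; ⁅_⁆; _∪_; _∩_; ∣_∣; _∈_; _∉_)
open import Data.List using (List; []; _∷_; foldr; length)
open import Data.List.Relation.Unary.All using (All)
open import Data.List.Relation.Unary.Any using (Any)
open import Data.List.Relation.Unary.Unique.Propositional using (Unique)
open import Data.Product using (Σ; _×_; ∃)
open import Data.Unit using () renaming (⊤ to Unit)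
open import Relation.Binary.PropositionalEquality using (_≡_)
open import Relation.Binary.Construct.Closure.ReflexiveTransitive using (Star)
open import Relation.Nullary using (¬_)

-- A hypergraph on vertex set Fin n is given by its list of edges
-- (each edge a subset of Fin n).

Simple : ∀ {n} → List (Subset n) → Set
Simple E = Unique E × All (λ e → 2 ≤ ∣ e ∣) E

Uniform : ∀ {n} → ℕ → List (Subset n) → Set
Uniform k E = All (λ e → ∣ e ∣ ≡ k) E

Adjacent : ∀ {n} → List (Subset n) → Fin n → Fin n → Set
Adjacent E u v = Any (λ e → (u ∈ e) × (v ∈ e)) E

Connected : ∀ {n} → List (Subset n) → Set
Connected {n} E = (u v : Fin n) → Star (Adjacent E) u v

InUnit : ℚ → Set
InUnit p = (0ℚ ℚ.< p) × (p ℚ.< 1ℚ)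

triggered : ∀ {n} → ℚ → Subset n → Subset n → Bool
triggered p F e = ℚ.ceiling (p ℚ.* (+ ∣ e ∣ ℚ./ 1)) ℤ.≤ᵇ + ∣ e ∩ F ∣

spread : ∀ {n} → ℚ → List (Subset n) → Subset n → Subset n
spread p E F = F ∪ foldr (λ e acc → if triggered p F e then e ∪ acc else acc) ⊥ E

ValidFrom : ∀ {n} → ℚ → List (Subset n) → Subset n → List (Fin n) → Set
ValidFrom p E F [] = Unit
ValidFrom p E F (u ∷ us) = (u ∉ F) × ValidFrom p E (spread p E F ∪ ⁅ u ⁆) us

finalFrom : ∀ {n} → ℚ → List (Subset n) → Subset n → List (Fin n) → Subset n
finalFrom p E F [] = F
finalFrom p E F (u ∷ us) = finalFrom p E (spread p E F ∪ ⁅ u ⁆) us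

-- burning sequence: F_0 = ∅, round 1 has no propagation (F_1 = {u_1}),
-- every vertex burned at the end of the last round.
IsBurningSeq : ∀ {n} → ℚ → List (Subset n) → List (Fin n) → Set
IsBurningSeq {n} p E [] = ⊥ {n} ≡ ⊤
IsBurningSeq p E (u ∷ us) = ValidFrom p E ⁅ u ⁆ us × finalFrom p E ⁅ u ⁆ us ≡ ⊤

BurningNumber : ∀ {n} → ℚ → List (Subset n) → ℕ → Set
BurningNumber {n} p E j =
  (Σ (List (Fin n)) λ us → IsBurningSeq p E us × length us ≡ j) ×
  (∀ us → IsBurningSeq p E us → j ≤ length us)

iterate : ∀ {A : Set} → (A → A) → ℕ → A → A
iterate f zero x = x
iterate f (suc m) x = f (iterate f m x)

IsLazyBurningSet : ∀ {n} → ℚ → List (Subset n) → Subset n → Set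
IsLazyBurningSet p E S = ∃ λ m → iterate (spread p E) m S ≡ ⊤

LazyBurningNumber : ∀ {n} → ℚ → List (Subset n) → ℕ → Set
LazyBurningNumber {n} p E j =
  (Σ (Subset n) λ S → IsLazyBurningSet p E S × ∣ S ∣ ≡ j) ×
  (∀ S → IsLazyBurningSet p E S → j ≤ ∣ S ∣)

PEmpty : ∀ {n} → List (Subset n) → ℕ → Set
PEmpty E j = ¬ (Σ ℚ λ p → InUnit p × BurningNumber p E j)

QEmpty : ∀ {n} → List (Subset n) → ℕ → Set
QEmpty E j = ¬ (Σ ℚ λ p → InUnit p × LazyBurningNumber p E j)

{-# OPTIONS --safe #-}

-- For a k-uniform hypergraph, the rule with proportion p is the threshold rule "an edge burns once
-- t = ⌈pk⌉ of its vertices do", and as p ranges over (0,1), t takes exactly the values 1, ..., k. So the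
-- burning number takes the k values b(1), ..., b(k), the lazy one l(1), ..., l(k), and the theorem follows
-- once both are strictly increasing in t ≤ k: then exactly k of the values 1, ..., n are attained.
--
-- Lazy game: some edge e fires from an optimal lazy set S for threshold t + 1, and removing a vertex of e
-- from S leaves a lazy set for threshold t, since e still fires.
-- Burning game: in an optimal game for threshold t + 1, the first edge to fire contains the source lit just
-- before; at threshold t that edge fires a round earlier, so the source can be skipped. If no edge ever
-- fires, the game lasts n rounds, whereas some game for threshold t < k lasts n - 1 rounds, because an edge
-- has k < n vertices.

module Submission where

open import Defs
open import Data.Nat using (ℕ; zero; suc; _+_; _*_; _∸_; _≤_; _<_; _≤ᵇ_; z≤n; s≤s; pred; _/_; _%_; >-nonZero)
import Data.Nat.Properties as ℕ
open import Data.Nat.DivMod using (m≡m%n+[m/n]*n; m%n<n)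
open import Data.Nat.Induction using (<-rec)
open import Data.Integer as ℤ using (+_; -[1+_]; +[1+_])
import Data.Integer.Properties as ℤ
open import Data.Rational as ℚ using (ℚ; mkℚ; toℚᵘ; fromℚᵘ)
import Data.Rational.Properties as ℚ
open import Data.Rational.Unnormalised as ℚᵘ using (ℚᵘ; mkℚᵘ; *<*; *≤*; 0ℚᵘ)
  renaming (_<_ to _<ᵘ_; _≤_ to _≤ᵘ_; _*_ to _*ᵘ_; _≃_ to _≃ᵘ_)
import Data.Rational.Unnormalised.Properties as ℚᵘ
open import Data.Bool using (Bool; true; false; T; if_then_else_)
import Data.Bool.Properties as Bool
open import Data.Unit using (tt)
open import Data.Fin using (Fin; zero; suc; toℕ; fromℕ<)
import Data.Fin.Properties as Fin
open import Data.Fin.Subset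
open import Data.Fin.Subset.Properties
open import Data.Vec using (_∷_; here; there)
import Data.Vec.Properties as Vec
open import Data.List using (List; []; _∷_; foldr; length)
open import Data.List.Relation.Unary.All as All using (All; []; _∷_)
open import Data.List.Relation.Unary.Any as Any using (Any; here; there)
open import Data.List.Relation.Unary.AllPairs using (_∷_)
open import Data.List.Membership.Propositional using (find; lose) renaming (_∈_ to _∈ₗ_)
open import Data.Product as Product using (Σ; ∃; _×_; _,_; proj₁; proj₂)
open import Data.Sum as Sum using (_⊎_; inj₁; inj₂)
open import Function using (id; _∘_)
open import Function.Bundles using (_⇔_; mk⇔; module Equivalence)
open import Relation.Nullary using (¬_; Dec; yes; no; ¬?; contradiction)
open import Relation.Nullary.Decidable using (_×-dec_; map′)
open import Relation.Unary using (Decidable)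
open import Relation.Binary.PropositionalEquality using (_≡_; _≢_; _≗_; refl; sym; trans; cong; subst; subst₂)

private
  variable
    n m c t t′ j k : ℕ
    F G A X Y S : Subset n
    x u y : Fin n

_≟ₛ_ : (p q : Subset n) → Dec (p ≡ q)
_≟ₛ_ = Vec.≡-dec Bool._≟_

⊤⊆⇒≡⊤ : ∀ {p : Subset n} → ⊤ ⊆ p → p ≡ ⊤
⊤⊆⇒≡⊤ ⊤⊆p = ⊆-antisym ⊆⊤ ⊤⊆p

≢⊤⇒∃∉ : ∀ {p : Subset n} → p ≢ ⊤ → ∃ λ x → x ∉ p
≢⊤⇒∃∉ {n} {p} p≢⊤ = Fin.¬∀⟶∃¬ n (_∈ p) (_∈? p) (λ all∈ → p≢⊤ (⊤⊆⇒≡⊤ λ {x} _ → all∈ x))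

⊥≢⊤ : Fin n → ⊥ {n} ≢ ⊤
⊥≢⊤ x ⊥≡⊤ = ∉⊥ (subst (x ∈_) (sym ⊥≡⊤) ∈⊤)

∈⇒∣∣>0 : ∀ {p : Subset n} → x ∈ p → 0 < ∣ p ∣
∈⇒∣∣>0 x∈p = ℕ.≤-<-trans z≤n (x∈p⇒∣p-x∣<∣p∣ x∈p)

≢∧∣≡∣⇒∃∉ : ∀ {p q : Subset n} → p ≢ q → ∣ q ∣ ≡ ∣ p ∣ → ∃ λ x → x ∉ p
≢∧∣≡∣⇒∃∉ {n} {p} {q} p≢q ∣q∣≡∣p∣ = ≢⊤⇒∃∉ λ p≡⊤ →
  p≢q (trans p≡⊤ (sym (∣p∣≡n⇒p≡⊤ (trans ∣q∣≡∣p∣ (trans (cong ∣_∣ p≡⊤) (∣⊤∣≡n n))))))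

∪-lub : ∀ {p q r : Subset n} → p ⊆ r → q ⊆ r → p ∪ q ⊆ r
∪-lub {p = p} {q = q} p⊆r q⊆r x∈p∪q with x∈p∪q⁻ p q x∈p∪q
... | inj₁ x∈p = p⊆r x∈p
... | inj₂ x∈q = q⊆r x∈q

∪-mono : ∀ {p q r s : Subset n} → p ⊆ r → q ⊆ s → p ∪ q ⊆ r ∪ s
∪-mono {r = r} {s} p⊆r q⊆s = ∪-lub (p⊆p∪q s ∘ p⊆r) (q⊆p∪q r s ∘ q⊆s)

x∉p-x : ∀ (p : Subset n) x → x ∉ p - x
x∉p-x (_ ∷ p) zero ()
x∉p-x (_ ∷ p) (suc x) (there x∈p-x) = x∉p-x p x x∈p-x

∣p∪⁅x⁆∣≡suc∣p∣ : ∀ {p : Subset n} {x} → x ∉ p → ∣ p ∪ ⁅ x ⁆ ∣ ≡ suc ∣ p ∣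
∣p∪⁅x⁆∣≡suc∣p∣ {p = false ∷ p} {zero} _ = cong suc (cong ∣_∣ (∪-identityʳ p))
∣p∪⁅x⁆∣≡suc∣p∣ {p = true ∷ p} {zero} x∉p = contradiction here x∉p
∣p∪⁅x⁆∣≡suc∣p∣ {p = false ∷ p} {suc x} x∉p = ∣p∪⁅x⁆∣≡suc∣p∣ (x∉p ∘ there)
∣p∪⁅x⁆∣≡suc∣p∣ {p = true ∷ p} {suc x} x∉p = cong suc (∣p∪⁅x⁆∣≡suc∣p∣ (x∉p ∘ there))

∣p∪⁅x⁆∣≤suc∣p∣ : ∀ (p : Subset n) x → ∣ p ∪ ⁅ x ⁆ ∣ ≤ suc ∣ p ∣
∣p∪⁅x⁆∣≤suc∣p∣ p x with x ∈? p
... | no x∉p = ℕ.≤-reflexive (∣p∪⁅x⁆∣≡suc∣p∣ x∉p)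
... | yes x∈p = ℕ.m≤n⇒m≤1+n (p⊆q⇒∣p∣≤∣q∣ (∪-lub id (λ y∈⁅x⁆ → subst (_∈ p) (sym (x∈⁅y⁆⇒x≡y _ y∈⁅x⁆)) x∈p)))

∣p∣≤suc∣p-x∣ : ∀ (p : Subset n) x → ∣ p ∣ ≤ suc ∣ p - x ∣
∣p∣≤suc∣p-x∣ p x = ℕ.≤-trans (p⊆q⇒∣p∣≤∣q∣ p⊆[p-x]∪⁅x⁆) (ℕ.≤-reflexive (∣p∪⁅x⁆∣≡suc∣p∣ (x∉p-x p x)))
  where
  p⊆[p-x]∪⁅x⁆ : p ⊆ (p - x) ∪ ⁅ x ⁆
  p⊆[p-x]∪⁅x⁆ {y} y∈p with y Fin.≟ x
  ... | yes refl = q⊆p∪q (p - x) ⁅ x ⁆ (x∈⁅x⁆ x)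
  ... | no y≢x = p⊆p∪q ⁅ x ⁆ (x∈p∧x≢y⇒x∈p-y y∈p y≢x)

⊆-or-∃∉ : ∀ (p q : Subset n) → p ⊆ q ⊎ ∃ λ x → x ∈ p × x ∉ q
⊆-or-∃∉ p q with Fin.any? (λ x → x ∈? p ×-dec ¬? (x ∈? q))
... | yes witness = inj₂ witness
... | no none = inj₁ p⊆q
  where
  p⊆q : p ⊆ q
  p⊆q {x} x∈p with x ∈? q
  ... | yes x∈q = x∈q
  ... | no x∉q = contradiction (x , x∈p , x∉q) none

IsLeast : (ℕ → Set) → ℕ → Set
IsLeast P j = P j × (∀ m → P m → j ≤ m)

IsLeast-map : ∀ {P Q : ℕ → Set} {j} → (∀ {m} → P m → Q m) → (∀ {m} → Q m → P m) → IsLeast P j → IsLeast Q j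
IsLeast-map P⇒Q Q⇒P (Pj , minimal) = P⇒Q Pj , λ m Qm → minimal m (Q⇒P Qm)

least : ∀ {P : ℕ → Set} → Decidable P → P n → Σ ℕ (IsLeast P)
least {n} {P} P? = <-rec (λ N → P N → Σ ℕ (IsLeast P)) search n
  where
  search : ∀ N → (∀ {M} → M < N → P M → Σ ℕ (IsLeast P)) → P N → Σ ℕ (IsLeast P)
  search N below pN with ℕ.anyUpTo? P? N
  ... | yes (M , M<N , pM) = below M<N pM
  ... | no nothing-below = N , pN , λ M pM → ℕ.≮⇒≥ (λ M<N → nothing-below (M , M<N , pM))

-- The burning game for a propagation operator

Op : ℕ → Set
Op n = Subset n → Subset n

Inflationary : Op n → Set
Inflationary s = ∀ {F} → F ⊆ s F

_≼_ : Op n → Op n → Set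
s ≼ s′ = ∀ {F G} → F ⊆ G → s F ⊆ s′ G

data Burnable {n} (s : Op n) : Subset n → ℕ → Set where
  burnt : F ≡ ⊤ → Burnable s F m
  light : ∀ u → u ∉ F → Burnable s (s F ∪ ⁅ u ⁆) m → Burnable s F (suc m)

module _ {s : Op n} where

  burnable? : ∀ F m → Dec (Burnable s F m)
  burnable? F m with F ≟ₛ ⊤
  ... | yes F≡⊤ = yes (burnt F≡⊤)
  burnable? F zero | no F≢⊤ = no λ { (burnt F≡⊤) → F≢⊤ F≡⊤ }
  burnable? F (suc m) | no F≢⊤ =
    map′ (λ (u , u∉F , b) → light u u∉F b) nextRound
         (Fin.any? λ u → ¬? (u ∈? F) ×-dec burnable? (s F ∪ ⁅ u ⁆) m)
    where
    nextRound : Burnable s F (suc m) → ∃ λ u → u ∉ F × Burnable s (s F ∪ ⁅ u ⁆) m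
    nextRound (burnt F≡⊤) = contradiction F≡⊤ F≢⊤
    nextRound (light u u∉F b) = u , u∉F , b

  burnable-≤ : m ≤ c → Burnable s F m → Burnable s F c
  burnable-≤ _ (burnt F≡⊤) = burnt F≡⊤
  burnable-≤ (s≤s m≤c) (light u u∉F b) = light u u∉F (burnable-≤ m≤c b)

  burnable-zero : Burnable s F 0 → F ≡ ⊤
  burnable-zero (burnt F≡⊤) = F≡⊤

  burnable-⊥-positive : Fin n → Burnable s ⊥ m → 0 < m
  burnable-⊥-positive x (burnt ⊥≡⊤) = contradiction ⊥≡⊤ (⊥≢⊤ x)
  burnable-⊥-positive x (light _ _ _) = s≤s z≤n

burnable-≗ : ∀ {s s′ : Op n} {F m} → s ≗ s′ → Burnable s F m → Burnable s′ F m
burnable-≗ s≗s′ (burnt F≡⊤) = burnt F≡⊤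
burnable-≗ {s′ = s′} {F = F} s≗s′ (light u u∉F b) =
  light u u∉F (subst (λ H → Burnable s′ (H ∪ ⁅ u ⁆) _) (s≗s′ F) (burnable-≗ s≗s′ b))

module _ {s s′ : Op n} (s-infl : Inflationary s) (s′-infl : Inflationary s′) (s≼s′ : s ≼ s′) where

  replaceSource : G ≢ ⊤ → X ⊆ s′ G → ∀ u → ∃ λ v → v ∉ G × X ∪ ⁅ u ⁆ ⊆ s′ G ∪ ⁅ v ⁆
  replaceSource {G = G} G≢⊤ X⊆s′G u with u ∈? G
  ... | no u∉G = u , u∉G , ∪-mono X⊆s′G id
  ... | yes u∈G with ≢⊤⇒∃∉ G≢⊤
  ... | v , v∉G = v , v∉G , ∪-lub (p⊆p∪q ⁅ v ⁆ ∘ X⊆s′G) (p⊆p∪q ⁅ v ⁆ ∘ s′-infl ∘ ⁅u⁆⊆G)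
    where
    ⁅u⁆⊆G : ⁅ u ⁆ ⊆ G
    ⁅u⁆⊆G w∈⁅u⁆ = subst (_∈ G) (sym (x∈⁅y⁆⇒x≡y _ w∈⁅u⁆)) u∈G

  simulate : F ⊆ G → Burnable s F m → Burnable s′ G m
  outpace : s F ⊆ s′ G → Burnable s F (suc m) → Burnable s′ G (suc m)

  simulate F⊆G (burnt refl) = burnt (⊤⊆⇒≡⊤ F⊆G)
  simulate F⊆G b@(light _ _ _) = outpace (s≼s′ F⊆G) b

  outpace {G = G} sF⊆s′G b with G ≟ₛ ⊤
  ... | yes G≡⊤ = burnt G≡⊤
  outpace {G = G} sF⊆s′G (burnt refl) | no G≢⊤ with ≢⊤⇒∃∉ G≢⊤
  ... | v , v∉G = light v v∉G (burnt (⊤⊆⇒≡⊤ (p⊆p∪q ⁅ v ⁆ ∘ sF⊆s′G ∘ s-infl)))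
  outpace sF⊆s′G (light u _ b) | no G≢⊤ with replaceSource G≢⊤ sF⊆s′G u
  ... | v , v∉G , sub = light v v∉G (simulate sub b)

module _ {s : Op n} (s-infl : Inflationary s) (s-mono : s ≼ s) where

  light-all : ∣ A ∣ ≤ c → F ⊆ G ∪ A → Burnable s F m → Burnable s G (c + m)
  light-all {A = A} {c} {G = G} ∣A∣≤c F⊆G∪A b with ⊆-or-∃∉ A G
  ... | inj₁ A⊆G = burnable-≤ (ℕ.m≤n+m _ c) (simulate s-infl s-infl s-mono (∪-lub id A⊆G ∘ F⊆G∪A) b)
  ... | inj₂ (a , a∈A , a∉G) with c
  ...   | zero = contradiction ∣A∣≤c (ℕ.<⇒≱ (ℕ.≤-<-trans z≤n (x∈p⇒∣p-x∣<∣p∣ a∈A)))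
  ...   | suc c = light a a∉G (light-all (ℕ.≤-pred (ℕ.<-≤-trans (x∈p⇒∣p-x∣<∣p∣ a∈A) ∣A∣≤c)) (G∪A⊆ ∘ F⊆G∪A) b)
    where
    G∪A⊆ : G ∪ A ⊆ (s G ∪ ⁅ a ⁆) ∪ (A - a)
    G∪A⊆ = ∪-lub (p⊆p∪q (A - a) ∘ p⊆p∪q ⁅ a ⁆ ∘ s-infl) A⊆
      where
      A⊆ : A ⊆ (s G ∪ ⁅ a ⁆) ∪ (A - a)
      A⊆ {y} y∈A with y Fin.≟ a
      ... | yes refl = p⊆p∪q (A - a) (q⊆p∪q (s G) ⁅ a ⁆ (x∈⁅x⁆ a))
      ... | no y≢a = q⊆p∪q (s G ∪ ⁅ a ⁆) (A - a) (x∈p∧x≢y⇒x∈p-y y∈A y≢a)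

  burnable-⊥ : Burnable s ⊥ n
  burnable-⊥ = burnable-≤ (ℕ.≤-reflexive (trans (ℕ.+-identityʳ _) (∣⊤∣≡n _)))
                     (light-all ℕ.≤-refl (q⊆p∪q ⊥ ⊤) (burnt refl))

-- Iterated propagation and lazy burning

Ignites : Op n → Subset n → Set
Ignites s S = ∃ λ m → iterate s m S ≡ ⊤

module _ {s : Op n} where

  iterate-suc : ∀ m X → iterate s (suc m) X ≡ iterate s m (s X)
  iterate-suc zero X = refl
  iterate-suc (suc m) X = cong s (iterate-suc m X)

  iterate-≗ : ∀ {s′ : Op n} → s ≗ s′ → ∀ m X → iterate s m X ≡ iterate s′ m X
  iterate-≗ s≗s′ zero X = refl
  iterate-≗ {s′} s≗s′ (suc m) X = trans (s≗s′ _) (cong s′ (iterate-≗ s≗s′ m X))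

  iterate-≼ : ∀ {s′ : Op n} → s ≼ s′ → X ⊆ Y → ∀ m → iterate s m X ⊆ iterate s′ m Y
  iterate-≼ s≼s′ X⊆Y zero = X⊆Y
  iterate-≼ s≼s′ X⊆Y (suc m) = s≼s′ (iterate-≼ s≼s′ X⊆Y m)

  iterate-closed : s ≼ s → s X ⊆ X → ∀ m → iterate s m X ⊆ X
  iterate-closed s-mono sX⊆X zero = id
  iterate-closed s-mono sX⊆X (suc m) = sX⊆X ∘ s-mono (iterate-closed s-mono sX⊆X m)

  module _ (s-infl : Inflationary s) (s-mono : s ≼ s) where

    ⊆-iterate : ∀ c → X ⊆ iterate s c X
    ⊆-iterate zero = id
    ⊆-iterate (suc c) = s-infl ∘ ⊆-iterate c

    -- Until the iteration is closed it gains a vertex per step, so it is closed after n steps.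
    grows-or-closed : ∀ i → i ≤ ∣ iterate s i X ∣ ⊎ s (iterate s i X) ⊆ iterate s i X
    grows-or-closed zero = inj₁ z≤n
    grows-or-closed {X = X} (suc i)
      with grows-or-closed {X = X} i | ⊆-or-∃∉ (s (iterate s i X)) (iterate s i X)
    ... | _ | inj₁ closed = inj₂ (s-mono closed)
    ... | inj₂ closed | _ = inj₂ (s-mono closed)
    ... | inj₁ i≤ | inj₂ (w , w∈ , w∉) = inj₁ (ℕ.≤-<-trans i≤ (p⊂q⇒∣p∣<∣q∣ (s-infl , w , w∈ , w∉)))

    iterate-saturates : ∀ m → iterate s m X ⊆ iterate s n X
    iterate-saturates zero = ⊆-iterate n
    iterate-saturates {X = X} (suc m) = closed ∘ s-mono (iterate-saturates {X = X} m)
      where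
      closed : s (iterate s n X) ⊆ iterate s n X
      closed with grows-or-closed {X = X} n
      ... | inj₂ closed = closed
      ... | inj₁ n≤ = subst (s (iterate s n X) ⊆_) (sym (∣p∣≡n⇒p≡⊤ (ℕ.≤-antisym (∣p∣≤n (iterate s n X)) n≤)))
                            ⊆⊤

    ignites? : ∀ S → Dec (Ignites s S)
    ignites? S = map′ (n ,_) saturated (iterate s n S ≟ₛ ⊤)
      where
      saturated : Ignites s S → iterate s n S ≡ ⊤
      saturated (m , ≡⊤) = ⊤⊆⇒≡⊤ (iterate-saturates m ∘ ⊆-reflexive (sym ≡⊤))

  ignites-closed : s ≼ s → s S ⊆ S → Ignites s S → S ≡ ⊤
  ignites-closed s-mono closed (m , ≡⊤) = ⊤⊆⇒≡⊤ (iterate-closed s-mono closed m ∘ ⊆-reflexive (sym ≡⊤))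

Ignitable : Op n → ℕ → Set
Ignitable s j = Σ (Subset _) λ S → ∣ S ∣ ≡ j × Ignites s S

ignitable? : ∀ {s : Op n} → Inflationary s → s ≼ s → Decidable (Ignitable s)
ignitable? s-infl s-mono j = anySubset? λ S → (∣ S ∣ ℕ.≟ j) ×-dec ignites? s-infl s-mono S

ignitable-≗ : ∀ {s s′ : Op n} {j} → s ≗ s′ → Ignitable s j → Ignitable s′ j
ignitable-≗ s≗s′ (S , ∣S∣≡j , m , ≡⊤) = S , ∣S∣≡j , m , trans (sym (iterate-≗ s≗s′ m S)) ≡⊤

-- Threshold propagation on a hypergraph

fire : (Subset n → Bool) → List (Subset n) → Subset n
fire b = foldr (λ e acc → if b e then e ∪ acc else acc) ⊥

module _ (b : Subset n → Bool) where

  ∈-fire⁻ : ∀ L → x ∈ fire b L → Any (λ e → T (b e) × x ∈ e) L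
  ∈-fire⁻ [] x∈⊥ = contradiction x∈⊥ ∉⊥
  ∈-fire⁻ (e ∷ L) x∈ with b e in be≡true
  ... | false = there (∈-fire⁻ L x∈)
  ... | true with x∈p∪q⁻ e (fire b L) x∈
  ...   | inj₁ x∈e = here (subst T (sym be≡true) tt , x∈e)
  ...   | inj₂ x∈fire = there (∈-fire⁻ L x∈fire)

  ∈-fire⁺ : ∀ L → Any (λ e → T (b e) × x ∈ e) L → x ∈ fire b L
  ∈-fire⁺ (e ∷ L) (here be×x∈e) with b e | be×x∈e
  ... | true | _ , x∈e = p⊆p∪q (fire b L) x∈e
  ∈-fire⁺ (e ∷ L) (there x∈fire) with b e
  ... | true = q⊆p∪q e (fire b L) (∈-fire⁺ L x∈fire)
  ... | false = ∈-fire⁺ L x∈fire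

fire-cong : ∀ {b b′ : Subset n → Bool} L → All (λ e → b e ≡ b′ e) L → fire b L ≡ fire b′ L
fire-cong [] [] = refl
fire-cong (e ∷ L) (be≡b′e ∷ rest) rewrite be≡b′e | fire-cong L rest = refl

∣p∣>0⇒∃∈ : ∀ (p : Subset n) → 0 < ∣ p ∣ → ∃ λ x → x ∈ p
∣p∣>0⇒∃∈ {n} p ∣p∣>0 with nonempty? p
... | yes nonempty = nonempty
... | no empty = contradiction (trans (cong ∣_∣ (Empty-unique empty)) (∣⊥∣≡0 n)) (ℕ.>⇒≢ ∣p∣>0)

module Threshold (E : List (Subset n)) where

  Fires : ℕ → Subset n → Subset n → Set
  Fires t F e = t ≤ ∣ e ∩ F ∣

  spreadAt : ℕ → Op n
  spreadAt t F = F ∪ fire (λ e → t ≤ᵇ ∣ e ∩ F ∣) E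

  ∈-spreadAt⁻ : x ∈ spreadAt t F → x ∈ F ⊎ Any (λ e → Fires t F e × x ∈ e) E
  ∈-spreadAt⁻ {t = t} {F} x∈ = Sum.map₂ (Any.map (λ (fires , x∈e) → ℕ.≤ᵇ⇒≤ t _ fires , x∈e) ∘ ∈-fire⁻ _ E)
                                  (x∈p∪q⁻ F _ x∈)

  ∈-spreadAt⁺ : Any (λ e → Fires t F e × x ∈ e) E → x ∈ spreadAt t F
  ∈-spreadAt⁺ {F = F} fired = q⊆p∪q F _ (∈-fire⁺ _ E (Any.map (λ (fires , x∈e) → ℕ.≤⇒≤ᵇ fires , x∈e) fired))

  spreadAt-infl : ∀ t → Inflationary (spreadAt t)
  spreadAt-infl t = p⊆p∪q _

  spreadAt-≼ : ∀ {t t′} → t′ ≤ t → spreadAt t ≼ spreadAt t′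
  spreadAt-≼ {t} {t′} t′≤t {F} {G} F⊆G x∈ with ∈-spreadAt⁻ {t = t} x∈
  ... | inj₁ x∈F = spreadAt-infl t′ (F⊆G x∈F)
  ... | inj₂ fired = ∈-spreadAt⁺ {t = t′} (Any.map (λ {e} → Product.map₁ (weaken {e})) fired)
    where
    weaken : ∀ {e} → Fires t F e → Fires t′ G e
    weaken {e} fires = ℕ.≤-trans t′≤t (ℕ.≤-trans fires (p⊆q⇒∣p∣≤∣q∣ e∩F⊆e∩G))
      where
      e∩F⊆e∩G : e ∩ F ⊆ e ∩ G
      e∩F⊆e∩G x∈ with x∈p∩q⁻ e F x∈
      ... | x∈e , x∈F = x∈p∩q⁺ (x∈e , F⊆G x∈F)

  spreadAt-mono : ∀ t → spreadAt t ≼ spreadAt t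
  spreadAt-mono t = spreadAt-≼ {t} ℕ.≤-refl

  fires-drop : ∀ e → Fires (suc t) F e → Fires t (F - x) e
  fires-drop {F = F} {x = x} e fires =
    ℕ.≤-pred (ℕ.≤-trans fires (ℕ.≤-trans (∣p∣≤suc∣p-x∣ (e ∩ F) x) (s≤s (p⊆q⇒∣p∣≤∣q∣ [e∩F]-x⊆e∩[F-x]))))
    where
    [e∩F]-x⊆e∩[F-x] : (e ∩ F) - x ⊆ e ∩ (F - x)
    [e∩F]-x⊆e∩[F-x] {y} y∈ with x∈p∩q⁻ e F (p─q⊆p (e ∩ F) ⁅ x ⁆ y∈)
    ... | y∈e , y∈F = x∈p∩q⁺ (y∈e , x∈p∧x≢y⇒x∈p-y y∈F λ { refl → x∉p-x (e ∩ F) x y∈ })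

  spreadAt-drop : ∀ {e} → e ∈ₗ E → x ∈ e → Fires (suc t) F e → spreadAt (suc t) F ⊆ spreadAt t (F - x)
  spreadAt-drop {x = x} {t = t} {e = e} e∈E x∈e fires {y} y∈ with ∈-spreadAt⁻ {t = suc t} y∈
  ... | inj₂ fired = ∈-spreadAt⁺ {t = t} (Any.map (λ {f} → Product.map₁ (fires-drop f)) fired)
  ... | inj₁ y∈F with y Fin.≟ x
  ...   | yes refl = ∈-spreadAt⁺ {t = t} (lose e∈E (fires-drop e fires , x∈e))
  ...   | no y≢x = spreadAt-infl t (x∈p∧x≢y⇒x∈p-y y∈F y≢x)

  Quiet : ℕ → Subset n → Set
  Quiet t F = ¬ Any (Fires t F) E

  fires? : ∀ t F → Dec (Any (Fires t F) E)
  fires? t F = Any.any? (λ e → t ℕ.≤? ∣ e ∩ F ∣) E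

  quiet-closed : Quiet t F → spreadAt t F ⊆ F
  quiet-closed {t = t} quiet x∈ with ∈-spreadAt⁻ {t = t} x∈
  ... | inj₁ x∈F = x∈F
  ... | inj₂ fired = contradiction (Any.map proj₁ fired) quiet

  quiet-⊥ : Quiet (suc t) ⊥
  quiet-⊥ fired with find fired
  ... | e , _ , fires = ℕ.≤⇒≯ z≤n (subst (suc _ ≤_) (trans (cong ∣_∣ (∩-zeroʳ e)) (∣⊥∣≡0 n)) fires)

  newly-fired-contains : ∀ {e} → Quiet t F → G ⊆ F ∪ ⁅ u ⁆ → e ∈ₗ E → Fires t G e → u ∈ e
  newly-fired-contains {F = F} {G = G} {u = u} {e = e} quiet G⊆F∪u e∈E fires with u ∈? e
  ... | yes u∈e = u∈e
  ... | no u∉e = contradiction (lose e∈E (ℕ.≤-trans fires (p⊆q⇒∣p∣≤∣q∣ e∩G⊆e∩F))) quiet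
    where
    e∩G⊆e∩F : e ∩ G ⊆ e ∩ F
    e∩G⊆e∩F w∈ with x∈p∩q⁻ e G w∈
    ... | w∈e , w∈G with x∈p∪q⁻ F ⁅ u ⁆ (G⊆F∪u w∈G)
    ...   | inj₁ w∈F = x∈p∩q⁺ (w∈e , w∈F)
    ...   | inj₂ w∈u = contradiction (subst (_∈ e) (x∈⁅y⁆⇒x≡y _ w∈u) w∈e) u∉e

  -- From a quiet burned set, the first edge to fire at threshold t + 1 contains the source just lit, so at
  -- threshold t it fires a round earlier and that source can be skipped. If no edge ever fires, every round
  -- burns one vertex only.
  saves-round-or-lights-all : Quiet (suc t) F → Burnable (spreadAt (suc t)) F (suc m) →
                              Burnable (spreadAt t) F m ⊎ n ≤ ∣ F ∣ + suc m
  saves-round-or-lights-all quiet (burnt F≡⊤) = inj₁ (burnt F≡⊤)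
  saves-round-or-lights-all {t = t} {F = F} {m = m} quiet (light u u∉F b) = continue m b (fires? (suc t) F′)
    where
    F′ = spreadAt (suc t) F ∪ ⁅ u ⁆

    F′⊆F∪u : F′ ⊆ F ∪ ⁅ u ⁆
    F′⊆F∪u = ∪-mono (quiet-closed quiet) id

    ∣F′∣≤ : ∣ F′ ∣ ≤ suc ∣ F ∣
    ∣F′∣≤ = ℕ.≤-trans (p⊆q⇒∣p∣≤∣q∣ F′⊆F∪u) (∣p∪⁅x⁆∣≤suc∣p∣ F u)

    continue : ∀ m → Burnable (spreadAt (suc t)) F′ m → Dec (Any (Fires (suc t) F′) E) →
               Burnable (spreadAt t) F m ⊎ n ≤ ∣ F ∣ + suc m
    continue zero b _ = inj₂ (ℕ.≤-trans n≤∣F′∣ (ℕ.≤-trans ∣F′∣≤ (ℕ.≤-reflexive (ℕ.+-comm 1 ∣ F ∣))))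
      where
      n≤∣F′∣ : n ≤ ∣ F′ ∣
      n≤∣F′∣ = ℕ.≤-reflexive (trans (sym (∣⊤∣≡n n)) (cong ∣_∣ (sym (burnable-zero b))))
    continue (suc m) b (no quiet′) =
      Sum.map (light u u∉F ∘ simulate (spreadAt-infl t) (spreadAt-infl t) (spreadAt-mono t) F′⊆sF∪u)
              (λ n≤ → ℕ.≤-trans n≤ (ℕ.≤-trans (ℕ.+-monoˡ-≤ (suc m) ∣F′∣≤)
                                               (ℕ.≤-reflexive (sym (ℕ.+-suc ∣ F ∣ (suc m))))))
              (saves-round-or-lights-all quiet′ b)
      where
      F′⊆sF∪u : F′ ⊆ spreadAt t F ∪ ⁅ u ⁆
      F′⊆sF∪u = ∪-mono (spreadAt-≼ (ℕ.n≤1+n t) id) id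
    continue (suc m) b (yes fired) with find fired
    ... | e , e∈E , fires =
      inj₁ (outpace (spreadAt-infl (suc t)) (spreadAt-infl t) (spreadAt-≼ (ℕ.n≤1+n t))
                    (spreadAt-mono t F′-u⊆F ∘ spreadAt-drop e∈E u∈e fires) b)
      where
      u∈e = newly-fired-contains quiet F′⊆F∪u e∈E fires

      F′-u⊆F : F′ - u ⊆ F
      F′-u⊆F {w} w∈ with x∈p∪q⁻ F ⁅ u ⁆ (F′⊆F∪u (p─q⊆p F′ ⁅ u ⁆ w∈))
      ... | inj₁ w∈F = w∈F
      ... | inj₂ w∈u = contradiction (subst (_∈ F′ - u) (x∈⁅y⁆⇒x≡y _ w∈u) w∈) (x∉p-x F′ u)

  -- Light all vertices but z ∈ e and y ∉ e, lighting y last: by then e fires and z burns with y.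
  burnable-pred-n : ∀ {e} → e ∈ₗ E → t < ∣ e ∣ → y ∉ e → Burnable (spreadAt t) ⊥ (pred n)
  burnable-pred-n {t = t} {y = y} {e = e} e∈E t<∣e∣ y∉e with ∣p∣>0⇒∃∈ e (ℕ.≤-<-trans z≤n t<∣e∣)
  ... | z , z∈e =
    burnable-≤ ∣lit∣+1≤pred-n (light-all (spreadAt-infl t) (spreadAt-mono t) ℕ.≤-refl (q⊆p∪q ⊥ lit) lastRound)
    where
    lit = ⊤ - y - z

    ∈lit : ∀ {w} → w ≢ y → w ≢ z → w ∈ lit
    ∈lit w≢y w≢z = x∈p∧x≢y⇒x∈p-y (x∈p∧x≢y⇒x∈p-y ∈⊤ w≢y) w≢z

    z≢y : z ≢ y
    z≢y refl = y∉e z∈e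

    e-fires : Fires t lit e
    e-fires = ℕ.≤-trans (ℕ.≤-pred (ℕ.≤-trans t<∣e∣ (∣p∣≤suc∣p-x∣ e z))) (p⊆q⇒∣p∣≤∣q∣ e-z⊆e∩lit)
      where
      e-z⊆e∩lit : e - z ⊆ e ∩ lit
      e-z⊆e∩lit {w} w∈ = x∈p∩q⁺ (w∈e , ∈lit (λ { refl → y∉e w∈e }) λ { refl → x∉p-x e z w∈ })
        where w∈e = p─q⊆p e ⁅ z ⁆ w∈

    lastRound : Burnable (spreadAt t) lit 1
    lastRound = light y (x∉p-x ⊤ y ∘ p─q⊆p (⊤ - y) ⁅ z ⁆) (burnt (⊤⊆⇒≡⊤ covered))
      where
      covered : ⊤ ⊆ spreadAt t lit ∪ ⁅ y ⁆
      covered {w} _ with w Fin.≟ y | w Fin.≟ z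
      ... | yes refl | _ = q⊆p∪q _ ⁅ y ⁆ (x∈⁅x⁆ y)
      ... | no _ | yes refl = p⊆p∪q ⁅ y ⁆ (∈-spreadAt⁺ {t = t} (lose e∈E (e-fires , z∈e)))
      ... | no w≢y | no w≢z = p⊆p∪q ⁅ y ⁆ (spreadAt-infl t (∈lit w≢y w≢z))

    ∣lit∣+1≤pred-n : ∣ lit ∣ + 1 ≤ pred n
    ∣lit∣+1≤pred-n = subst (_≤ pred n) (ℕ.+-comm 1 ∣ lit ∣)
                            (ℕ.suc[m]≤n⇒m≤pred[n] (ℕ.≤-trans (s≤s ∣lit∣<∣⊤-y∣) ∣⊤-y∣<n))
      where
      ∣lit∣<∣⊤-y∣ = x∈p⇒∣p-x∣<∣p∣ (x∈p∧x≢y⇒x∈p-y ∈⊤ z≢y)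
      ∣⊤-y∣<n = ℕ.<-≤-trans (x∈p⇒∣p-x∣<∣p∣ (∈⊤ {x = y})) (ℕ.≤-reflexive (∣⊤∣≡n n))

  burningNumber-spec : ∀ t → Σ ℕ (IsLeast (Burnable (spreadAt t) ⊥))
  burningNumber-spec t = least (burnable? ⊥) (burnable-⊥ (spreadAt-infl t) (spreadAt-mono t))

  burningNumber : ℕ → ℕ
  burningNumber t = proj₁ (burningNumber-spec t)

  burningNumber-isLeast : ∀ t → IsLeast (Burnable (spreadAt t) ⊥) (burningNumber t)
  burningNumber-isLeast t = proj₂ (burningNumber-spec t)

  burningNumber≤n : ∀ t → burningNumber t ≤ n
  burningNumber≤n t = proj₂ (burningNumber-isLeast t) n (burnable-⊥ (spreadAt-infl t) (spreadAt-mono t))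

  burningNumber>0 : Fin n → ∀ t → 0 < burningNumber t
  burningNumber>0 x t = burnable-⊥-positive x (proj₁ (burningNumber-isLeast t))

  burningNumber-< : ∀ {e} → e ∈ₗ E → suc t ≤ ∣ e ∣ → y ∉ e → burningNumber t < burningNumber (suc t)
  burningNumber-< {t = t} {y = y} e∈E t<∣e∣ y∉e = beaten (proj₁ (burningNumber-isLeast (suc t)))
    where
    fastest = proj₂ (burningNumber-isLeast t)

    beaten : Burnable (spreadAt (suc t)) ⊥ m → burningNumber t < m
    beaten (burnt ⊥≡⊤) = contradiction ⊥≡⊤ (⊥≢⊤ y)
    beaten {suc m} b@(light _ _ _) with saves-round-or-lights-all quiet-⊥ b
    ... | inj₁ b′ = s≤s (fastest m b′)
    ... | inj₂ n≤∣⊥∣+1+m =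
      s≤s (ℕ.≤-trans (fastest (pred n) (burnable-pred-n e∈E (ℕ.<-≤-trans (ℕ.n<1+n t) t<∣e∣) y∉e))
                     (ℕ.pred-mono-≤ (subst (λ k → n ≤ k + suc m) (∣⊥∣≡0 n) n≤∣⊥∣+1+m)))

  lazyNumber-spec : ∀ t → Σ ℕ (IsLeast (Ignitable (spreadAt t)))
  lazyNumber-spec t = least (ignitable? (spreadAt-infl t) (spreadAt-mono t)) (⊤ , ∣⊤∣≡n n , 0 , refl)

  lazyNumber : ℕ → ℕ
  lazyNumber t = proj₁ (lazyNumber-spec t)

  lazyNumber-isLeast : ∀ t → IsLeast (Ignitable (spreadAt t)) (lazyNumber t)
  lazyNumber-isLeast t = proj₂ (lazyNumber-spec t)

  lazyNumber≤n : ∀ t → lazyNumber t ≤ n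
  lazyNumber≤n t = proj₂ (lazyNumber-isLeast t) n (⊤ , ∣⊤∣≡n n , 0 , refl)

  ignites-nonempty : Fin n → Ignites (spreadAt (suc t)) S → ∃ λ x → x ∈ S
  ignites-nonempty {t = t} {S = S} y ignites with nonempty? S
  ... | yes nonempty = nonempty
  ... | no empty = contradiction ⊥≡⊤ (⊥≢⊤ y)
    where
    ⊥≡⊤ = ignites-closed (spreadAt-mono (suc t)) (quiet-closed quiet-⊥)
                         (subst (Ignites _) (Empty-unique empty) ignites)

  lazyNumber>0 : Fin n → ∀ t → 0 < lazyNumber (suc t)
  lazyNumber>0 y t with proj₁ (lazyNumber-isLeast (suc t))
  ... | S , ∣S∣≡ , ignites = subst (0 <_) ∣S∣≡ (∈⇒∣∣>0 (proj₂ (ignites-nonempty y ignites)))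

  ignites-drop : ∀ {e₀} → e₀ ∈ₗ E → suc t ≤ ∣ e₀ ∣ → Ignites (spreadAt (suc t)) S →
                 ∃ λ x → x ∈ S × Ignites (spreadAt t) (S - x)
  ignites-drop {t = t} {S = S} {e₀ = e₀} e₀∈E t<∣e₀∣ (m , ≡⊤) with fires? (suc t) S
  ... | no quiet = contradiction (lose e₀∈E e₀-fires) quiet
    where
    S≡⊤ = ignites-closed (spreadAt-mono (suc t)) (quiet-closed quiet) (m , ≡⊤)
    e₀-fires : Fires (suc t) S e₀
    e₀-fires = subst (λ X → suc t ≤ ∣ e₀ ∩ X ∣) (sym S≡⊤)
                     (subst (λ X → suc t ≤ ∣ X ∣) (sym (∩-identityʳ e₀)) t<∣e₀∣)
  ... | yes fired with find fired
  ...   | e , e∈E , fires with ∣p∣>0⇒∃∈ (e ∩ S) (ℕ.≤-trans (s≤s z≤n) fires)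
  ...     | x , x∈e∩S with x∈p∩q⁻ e S x∈e∩S
  ...       | x∈e , x∈S = x , x∈S , suc m , ⊤⊆⇒≡⊤ (subst (_ ⊆_) (sym (iterate-suc m (S - x))) ⊤⊆)
    where
    ⊤⊆ : ⊤ ⊆ iterate (spreadAt t) m (spreadAt t (S - x))
    ⊤⊆ = iterate-≼ (spreadAt-≼ (ℕ.n≤1+n t)) (spreadAt-drop e∈E x∈e fires) m
       ∘ iterate-≼ (spreadAt-mono (suc t)) (spreadAt-infl (suc t)) m
       ∘ ⊆-reflexive (sym ≡⊤)

  lazyNumber-< : ∀ {e₀} → e₀ ∈ₗ E → suc t ≤ ∣ e₀ ∣ → lazyNumber t < lazyNumber (suc t)
  lazyNumber-< {t = t} e₀∈E t<∣e₀∣ with proj₁ (lazyNumber-isLeast (suc t))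
  ... | S , ∣S∣≡ , ignites with ignites-drop e₀∈E t<∣e₀∣ ignites
  ... | x , x∈S , ignites′ =
    ℕ.≤-<-trans (proj₂ (lazyNumber-isLeast t) _ (S - x , refl , ignites′))
                (subst (∣ S - x ∣ <_) ∣S∣≡ (x∈p⇒∣p-x∣<∣p∣ x∈S))

-- Ceilings

_/1 : ℕ → ℚᵘ
t /1 = mkℚᵘ (+ t) 0

module _ {a b d : ℕ} where

  /1<ᵘ : a * suc d < b → a /1 <ᵘ mkℚᵘ (+ b) d
  /1<ᵘ a*D<b = *<* (subst₂ ℤ._<_ (ℤ.pos-* a (suc d)) (ℤ.pos-* b 1)
                      (ℤ.+<+ (subst (a * suc d <_) (sym (ℕ.*-identityʳ b)) a*D<b)))

  ᵘ</1 : b < a * suc d → mkℚᵘ (+ b) d <ᵘ a /1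
  ᵘ</1 b<a*D = *<* (subst₂ ℤ._<_ (ℤ.pos-* b 1) (ℤ.pos-* a (suc d))
                      (ℤ.+<+ (subst (_< a * suc d) (sym (ℕ.*-identityʳ b)) b<a*D)))

  ᵘ≤/1 : b ≤ a * suc d → mkℚᵘ (+ b) d ≤ᵘ a /1
  ᵘ≤/1 b≤a*D = *≤* (subst₂ ℤ._≤_ (ℤ.pos-* b 1) (ℤ.pos-* a (suc d))
                      (ℤ.+≤+ (subst (_≤ a * suc d) (sym (ℕ.*-identityʳ b)) b≤a*D)))

/1-mono-≤ : ∀ {a b} → a ≤ b → a /1 ≤ᵘ b /1
/1-mono-≤ {a} {b} a≤b = *≤* (subst₂ ℤ._≤_ (sym (ℤ.*-identityʳ (+ a))) (sym (ℤ.*-identityʳ (+ b))) (ℤ.+≤+ a≤b))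

/1-between : ∀ {a b x} → a /1 <ᵘ x → x ≤ᵘ b /1 → a < b
/1-between {a} {b} a<x x≤b with ℚᵘ.<-≤-trans a<x x≤b
... | *<* a*1<b*1 = ℤ.drop‿+<+ (subst₂ ℤ._<_ (ℤ.*-identityʳ (+ a)) (ℤ.*-identityʳ (+ b)) a*1<b*1)

-- ℤ.- (-[1+ a ] ℤ./ℕ suc d) is the ceiling of (1 + a) / (1 + d), see ceiling-spec.
ceiling-pos : ∀ a d → ∃ λ t → ℤ.- (-[1+ a ] ℤ./ℕ suc d) ≡ + suc t × t * suc d < suc a × suc a ≤ suc t * suc d
ceiling-pos a d with suc a % suc d | m≡m%n+[m/n]*n (suc a) (suc d) | m%n<n (suc a) (suc d)
... | zero | suc-a≡ | _ with suc a / suc d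
...   | zero = contradiction suc-a≡ λ ()
...   | suc t =
  t , refl , subst (t * suc d <_) (sym suc-a≡) (ℕ.m<n+m (t * suc d) (s≤s z≤n)) , ℕ.≤-reflexive suc-a≡
ceiling-pos a d | suc r | suc-a≡ | r<D =
  q , refl , subst (q * suc d <_) (sym suc-a≡) (ℕ.m<n+m (q * suc d) (s≤s z≤n)) ,
  subst (_≤ suc q * suc d) (sym suc-a≡) (ℕ.+-monoˡ-≤ (q * suc d) (ℕ.<⇒≤ r<D))
  where q = suc a / suc d

ceiling-spec : ∀ q → 0ℚᵘ <ᵘ toℚᵘ q → ∃ λ t → ℚ.ceiling q ≡ + suc t × t /1 <ᵘ toℚᵘ q × toℚᵘ q ≤ᵘ suc t /1
ceiling-spec (mkℚ (+ zero) _ _) (*<* 0<0) = contradiction 0<0 (ℤ.<-irrefl refl)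
ceiling-spec (mkℚ +[1+ a ] d _) _ with ceiling-pos a d
... | t , ⌈q⌉≡ , t*D<a , a≤suc-t*D =
  t , trans (cong ℤ.-_ (ℤ.*-identityˡ _)) ⌈q⌉≡ , /1<ᵘ t*D<a , ᵘ≤/1 a≤suc-t*D
ceiling-spec (mkℚ -[1+ _ ] _ _) (*<* ())

ceiling-between : ∀ q t → t /1 <ᵘ toℚᵘ q → toℚᵘ q ≤ᵘ suc t /1 → ℚ.ceiling q ≡ + suc t
ceiling-between q t t<q q≤1+t with ceiling-spec q (ℚᵘ.≤-<-trans (/1-mono-≤ z≤n) t<q)
... | t′ , ⌈q⌉≡ , t′<q , q≤1+t′ =
  trans ⌈q⌉≡ (cong (λ i → + suc i) (ℕ.≤-antisym (ℕ.≤-pred (/1-between t′<q q≤1+t))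
                                               (ℕ.≤-pred (/1-between t<q q≤1+t′))))

toℚᵘ-*-/1 : ∀ p k → toℚᵘ (p ℚ.* (+ k ℚ./ 1)) ≃ᵘ toℚᵘ p *ᵘ k /1
toℚᵘ-*-/1 p k = ℚᵘ.≃-trans (ℚ.toℚᵘ-homo-* p (+ k ℚ./ 1)) (ℚᵘ.*-congˡ {toℚᵘ p} (ℚ.toℚᵘ-fromℚᵘ (k /1)))

scaled-bounds : ∀ {p} k → InUnit p →
                0ℚᵘ <ᵘ toℚᵘ (p ℚ.* (+ suc k ℚ./ 1)) × toℚᵘ (p ℚ.* (+ suc k ℚ./ 1)) <ᵘ suc k /1
scaled-bounds {p} k (0<p , p<1) =
  ℚᵘ.<-respʳ-≃ pk≃ (ℚᵘ.<-respˡ-≃ (ℚᵘ.*-zeroˡ (suc k /1)) (ℚᵘ.*-monoˡ-<-pos (suc k /1) (ℚ.toℚᵘ-mono-< 0<p))) ,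
  ℚᵘ.<-respˡ-≃ pk≃ (ℚᵘ.<-respʳ-≃ (ℚᵘ.*-identityˡ (suc k /1)) (ℚᵘ.*-monoˡ-<-pos (suc k /1) (ℚ.toℚᵘ-mono-< p<1)))
  where
  pk≃ = ℚᵘ.≃-sym (toℚᵘ-*-/1 p (suc k))

ceiling-threshold : ∀ {k p} → 0 < k → InUnit p → ∃ λ t → t < k × ℚ.ceiling (p ℚ.* (+ k ℚ./ 1)) ≡ + suc t
ceiling-threshold {suc k} _ 0<p<1 with scaled-bounds k 0<p<1
... | 0<pk , pk<k with ceiling-spec _ 0<pk
...   | t , ⌈pk⌉≡ , t<pk , _ = t , /1-between t<pk (ℚᵘ.<⇒≤ pk<k) , ⌈pk⌉≡

-- The witness is p = (t + 1) / (k + 1): then p k = (t + 1) k / (k + 1) lies in (t, t + 1].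
threshold-attained : ∀ {k t} → t < k → ∃ λ p → InUnit p × ℚ.ceiling (p ℚ.* (+ k ℚ./ 1)) ≡ + suc t
threshold-attained {suc k} {t} (s≤s t≤k) =
  p , (ℚ.toℚᵘ-cancel-< 0<p , ℚ.toℚᵘ-cancel-< p<1) ,
  ceiling-between q t (ℚᵘ.<-respʳ-≃ (ℚᵘ.≃-sym q≃pk) t<pk) (ℚᵘ.≤-respˡ-≃ (ℚᵘ.≃-sym q≃pk) pk≤1+t)
  where
  p = fromℚᵘ (mkℚᵘ (+ suc t) (suc k))
  q = p ℚ.* (+ suc k ℚ./ 1)
  pk = mkℚᵘ (+ (suc t * suc k)) (suc k * 1)
  p≃ = ℚ.toℚᵘ-fromℚᵘ (mkℚᵘ (+ suc t) (suc k))

  0<p : 0 /1 <ᵘ toℚᵘ p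
  0<p = ℚᵘ.<-respʳ-≃ (ℚᵘ.≃-sym p≃) (/1<ᵘ (s≤s z≤n))

  p<1 : toℚᵘ p <ᵘ 1 /1
  p<1 = ℚᵘ.<-respˡ-≃ (ℚᵘ.≃-sym p≃) (ᵘ</1 (subst (suc t <_) (sym (ℕ.*-identityˡ _)) (s≤s (s≤s t≤k))))

  q≃pk : toℚᵘ q ≃ᵘ pk
  q≃pk = ℚᵘ.≃-trans (toℚᵘ-*-/1 p (suc k)) (ℚᵘ.*-congʳ {suc k /1} p≃)

  k*1≡k = ℕ.*-identityʳ (suc k)

  t<pk : t /1 <ᵘ pk
  t<pk = /1<ᵘ (subst (λ d → t * suc d < suc t * suc k) (sym k*1≡k)
                (subst (_< suc t * suc k) (sym (ℕ.*-suc t (suc k))) (ℕ.+-monoˡ-< (t * suc k) (s≤s t≤k))))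

  pk≤1+t : pk ≤ᵘ suc t /1
  pk≤1+t = ᵘ≤/1 (ℕ.*-monoʳ-≤ (suc t) (subst (suc k ≤_) (cong suc (sym k*1≡k)) (ℕ.n≤1+n (suc k))))

-- The proportion rule as a threshold rule

module _ {n} (p : ℚ) (E : List (Subset n)) where

  sequence⇒burnable : ∀ us → ValidFrom p E F us → finalFrom p E F us ≡ ⊤ → Burnable (spread p E) F (length us)
  sequence⇒burnable [] _ F≡⊤ = burnt F≡⊤
  sequence⇒burnable (u ∷ us) (u∉F , valid) final = light u u∉F (sequence⇒burnable us valid final)

  burnable⇒sequence : Burnable (spread p E) F m →
                      ∃ λ us → length us ≤ m × ValidFrom p E F us × finalFrom p E F us ≡ ⊤
  burnable⇒sequence (burnt F≡⊤) = [] , z≤n , tt , F≡⊤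
  burnable⇒sequence (light u u∉F b) with burnable⇒sequence b
  ... | us , len≤ , valid , final = u ∷ us , s≤s len≤ , (u∉F , valid) , final

  module _ (spread-⊥ : spread p E ⊥ ≡ ⊥) where

    firstRound : ∀ u → spread p E ⊥ ∪ ⁅ u ⁆ ≡ ⁅ u ⁆
    firstRound u = trans (cong (_∪ ⁅ u ⁆) spread-⊥) (∪-identityˡ ⁅ u ⁆)

    isBurningSeq⇒burnable : ∀ us → IsBurningSeq p E us → Burnable (spread p E) ⊥ (length us)
    isBurningSeq⇒burnable [] ⊥≡⊤ = burnt ⊥≡⊤
    isBurningSeq⇒burnable (u ∷ us) (valid , final) =
      light u ∉⊥ (subst (λ F → Burnable _ F _) (sym (firstRound u)) (sequence⇒burnable us valid final))

    burnable⇒isBurningSeq : Burnable (spread p E) ⊥ m → ∃ λ us → length us ≤ m × IsBurningSeq p E us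
    burnable⇒isBurningSeq (burnt ⊥≡⊤) = [] , z≤n , ⊥≡⊤
    burnable⇒isBurningSeq (light u _ b) with burnable⇒sequence (subst (λ F → Burnable _ F _) (firstRound u) b)
    ... | us , len≤ , valid , final = u ∷ us , s≤s len≤ , valid , final

    burningNumber-fromLeast : IsLeast (Burnable (spread p E) ⊥) j → BurningNumber p E j
    burningNumber-fromLeast (b , fastest) with burnable⇒isBurningSeq b
    ... | us , len≤ , seq =
      (us , seq , ℕ.≤-antisym len≤ (fastest _ (isBurningSeq⇒burnable us seq))) ,
      λ us′ seq′ → fastest _ (isBurningSeq⇒burnable us′ seq′)

  lazyNumber-fromLeast : IsLeast (Ignitable (spread p E)) j → LazyBurningNumber p E j
  lazyNumber-fromLeast ((S , ∣S∣≡j , ignites) , smallest) =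
    (S , ignites , ∣S∣≡j) , λ S′ ignites′ → smallest _ (S′ , refl , ignites′)

  burningNumber-unique : ∀ {i j} → BurningNumber p E i → BurningNumber p E j → i ≡ j
  burningNumber-unique {i} {j} ((us , seq , len≡i) , i≤) ((us′ , seq′ , len≡j) , j≤) =
    ℕ.≤-antisym (subst (i ≤_) len≡j (i≤ us′ seq′)) (subst (j ≤_) len≡i (j≤ us seq))

  lazyNumber-unique : ∀ {i j} → LazyBurningNumber p E i → LazyBurningNumber p E j → i ≡ j
  lazyNumber-unique {i} {j} ((S , ign , ∣S∣≡i) , i≤) ((S′ , ign′ , ∣S′∣≡j) , j≤) =
    ℕ.≤-antisym (subst (i ≤_) ∣S′∣≡j (i≤ S′ ign′)) (subst (j ≤_) ∣S∣≡i (j≤ S ign))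

module _ {n k} {E : List (Subset n)} (uniform : Uniform k E) where

  open Threshold E

  spread≗spreadAt : ∀ {p t} → ℚ.ceiling (p ℚ.* (+ k ℚ./ 1)) ≡ + t → spread p E ≗ spreadAt t
  spread≗spreadAt {p} {t} ⌈pk⌉≡t F = cong (F ∪_) (fire-cong E (All.map (λ {e} → triggered≡ {e}) uniform))
    where
    triggered≡ : ∀ {e} → ∣ e ∣ ≡ k → triggered p F e ≡ (t ≤ᵇ ∣ e ∩ F ∣)
    triggered≡ {e} ∣e∣≡k = trans (cong (λ i → ℚ.ceiling (p ℚ.* (+ i ℚ./ 1)) ℤ.≤ᵇ + ∣ e ∩ F ∣) ∣e∣≡k)
                                  (cong (ℤ._≤ᵇ + ∣ e ∩ F ∣) ⌈pk⌉≡t)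

  module _ {p t} (⌈pk⌉≡1+t : ℚ.ceiling (p ℚ.* (+ k ℚ./ 1)) ≡ + suc t) where

    private
      spread≗ : spread p E ≗ spreadAt (suc t)
      spread≗ = spread≗spreadAt {p} {suc t} ⌈pk⌉≡1+t

    burningNumber-at : BurningNumber p E (burningNumber (suc t))
    burningNumber-at = burningNumber-fromLeast p E spread-⊥
      (IsLeast-map (burnable-≗ (sym ∘ spread≗)) (burnable-≗ spread≗) (burningNumber-isLeast (suc t)))
      where
      spread-⊥ = trans (spread≗ ⊥) (⊆-antisym (quiet-closed quiet-⊥) ⊥⊆)

    lazyNumber-at : LazyBurningNumber p E (lazyNumber (suc t))
    lazyNumber-at = lazyNumber-fromLeast p E
      (IsLeast-map (ignitable-≗ (sym ∘ spread≗)) (ignitable-≗ spread≗) (lazyNumber-isLeast (suc t)))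

-- Counting the attained values

strictly-increasing : ∀ {f : ℕ → ℕ} → (∀ {a} → suc a < k → f a < f (suc a)) →
                      ∀ {a b} → a < b → b < k → f a < f b
strictly-increasing step {a} {suc b} a<1+b 1+b<k with ℕ.m≤n⇒m<n∨m≡n (ℕ.≤-pred a<1+b)
... | inj₂ refl = step 1+b<k
... | inj₁ a<b = ℕ.<-trans (strictly-increasing step a<b (ℕ.<-trans (ℕ.n<1+n b) 1+b<k)) (step 1+b<k)

module _ (x : ℕ → Fin n) where

  image : ℕ → Subset n
  image zero = ⊥
  image (suc t) = image t ∪ ⁅ x t ⁆

  ∈-image⁺ : t′ < t → x t′ ∈ image t
  ∈-image⁺ {t′} {suc t} (s≤s t′≤t) with ℕ.m≤n⇒m<n∨m≡n t′≤t
  ... | inj₁ t′<t = p⊆p∪q ⁅ x t ⁆ (∈-image⁺ t′<t)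
  ... | inj₂ refl = q⊆p∪q (image t) ⁅ x t ⁆ (x∈⁅x⁆ (x t))

  ∈-image⁻ : ∀ {i} → i ∈ image t → ∃ λ t′ → t′ < t × x t′ ≡ i
  ∈-image⁻ {zero} i∈⊥ = contradiction i∈⊥ ∉⊥
  ∈-image⁻ {suc t} i∈ with x∈p∪q⁻ (image t) ⁅ x t ⁆ i∈
  ... | inj₁ i∈image with ∈-image⁻ i∈image
  ...   | t′ , t′<t , xt′≡i = t′ , ℕ.m<n⇒m<1+n t′<t , xt′≡i
  ∈-image⁻ {suc t} i∈ | inj₂ i∈⁅xt⁆ = t , ℕ.≤-refl , sym (x∈⁅y⁆⇒x≡y _ i∈⁅xt⁆)

  ∣image∣ : (∀ {a b} → a < b → b < t → x a ≢ x b) → ∣ image t ∣ ≡ t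
  ∣image∣ {zero} _ = ∣⊥∣≡0 n
  ∣image∣ {suc t} injective =
    trans (∣p∪⁅x⁆∣≡suc∣p∣ xt∉image) (cong suc (∣image∣ λ a<b b<t → injective a<b (ℕ.m<n⇒m<1+n b<t)))
    where
    xt∉image : x t ∉ image t
    xt∉image xt∈ with ∈-image⁻ xt∈
    ... | t′ , t′<t , xt′≡xt = injective t′<t ℕ.≤-refl xt′≡xt

module _ {n k : ℕ} (Num : ℚ → ℕ → Set) where

  Attained : ℕ → Set
  Attained j = Σ ℚ λ p → InUnit p × Num p j

  module _ (f : ℕ → ℕ) (0<k : 0 < k)
           (functional : ∀ {p i j} → Num p i → Num p j → i ≡ j)
           (at-threshold : ∀ {p t} → ℚ.ceiling (p ℚ.* (+ k ℚ./ 1)) ≡ + suc t → Num p (f t)) where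

    attained⇔ : ∀ {j} → Attained j ⇔ ∃ λ t → t < k × f t ≡ j
    attained⇔ = mk⇔ toThreshold fromThreshold
      where
      toThreshold : Attained _ → ∃ λ t → t < k × f t ≡ _
      toThreshold (p , 0<p<1 , num) with ceiling-threshold 0<k 0<p<1
      ... | t , t<k , ⌈pk⌉≡ = t , t<k , functional (at-threshold ⌈pk⌉≡) num
      fromThreshold : (∃ λ t → t < k × f t ≡ _) → Attained _
      fromThreshold (t , t<k , ft≡j) with threshold-attained t<k
      ... | p , 0<p<1 , ⌈pk⌉≡ = p , 0<p<1 , subst (Num p) ft≡j (at-threshold ⌈pk⌉≡)

    emptyIntervals : (∀ {a} → suc a < k → f a < f (suc a)) → (∀ t → 0 < f t × f t ≤ n) →
                     Σ (Subset n) λ S → ∣ S ∣ ≡ n ∸ k × ((i : Fin n) → (i ∈ S) ⇔ (¬ Attained (suc (toℕ i))))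
    emptyIntervals step range = ∁ (image index k) , ∣S∣≡n∸k , λ i → mk⇔ (to i) (from i)
      where
      suc-pred-f : ∀ t → suc (pred (f t)) ≡ f t
      suc-pred-f t = ℕ.suc-pred (f t) {{>-nonZero (proj₁ (range t))}}

      index : ℕ → Fin n
      index t = fromℕ< (subst (_≤ n) (sym (suc-pred-f t)) (proj₂ (range t)))

      suc-index≡f : ∀ t → suc (toℕ (index t)) ≡ f t
      suc-index≡f t = trans (cong suc (Fin.toℕ-fromℕ< _)) (suc-pred-f t)

      ∣S∣≡n∸k : ∣ ∁ (image index k) ∣ ≡ n ∸ k
      ∣S∣≡n∸k = trans (∣∁p∣≡n∸∣p∣ (image index k)) (cong (n ∸_) (∣image∣ index injective))
        where
        injective : ∀ {a b} → a < b → b < k → index a ≢ index b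
        injective a<b b<k ia≡ib =
          ℕ.<-irrefl (trans (sym (suc-index≡f _)) (trans (cong (suc ∘ toℕ) ia≡ib) (suc-index≡f _)))
                     (strictly-increasing step a<b b<k)

      to : ∀ i → i ∈ ∁ (image index k) → ¬ Attained (suc (toℕ i))
      to i i∈S attained with Equivalence.to attained⇔ attained
      ... | t , t<k , ft≡ = x∈∁p⇒x∉p i∈S (subst (_∈ image index k) it≡i (∈-image⁺ index t<k))
        where
        it≡i : index t ≡ i
        it≡i = Fin.toℕ-injective (ℕ.suc-injective (trans (suc-index≡f t) ft≡))

      from : ∀ i → ¬ Attained (suc (toℕ i)) → i ∈ ∁ (image index k)
      from i unattained with i ∈? image index k
      ... | no i∉image = x∉p⇒x∈∁p i∉image
      ... | yes i∈image with ∈-image⁻ index i∈image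
      ...   | t , t<k , it≡i =
        contradiction (Equivalence.from attained⇔ (t , t<k , trans (sym (suc-index≡f t)) (cong (suc ∘ toℕ) it≡i)))
          unattained

corollary3p10 : (n k : ℕ) (E : List (Subset n)) →
    Simple E → Connected E → Uniform k E → 1 < length E →
    (Σ (Subset n) λ S → ∣ S ∣ ≡ n ∸ k × ((i : Fin n) → (i ∈ S) ⇔ PEmpty E (suc (toℕ i))))
    × (Σ (Subset n) λ S → ∣ S ∣ ≡ n ∸ k × ((i : Fin n) → (i ∈ S) ⇔ QEmpty E (suc (toℕ i))))
corollary3p10 n k [] _ _ _ ()
corollary3p10 n k (_ ∷ []) _ _ _ (s≤s ())
corollary3p10 n k E@(e ∷ e′ ∷ _) (((e≢e′ ∷ _) ∷ _) , (2≤∣e∣ ∷ _)) _ uniform@(∣e∣≡k ∷ ∣e′∣≡k ∷ _) _ =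
  emptyIntervals (λ p → BurningNumber p E) (λ t → burningNumber (suc t)) 0<k
    (λ {p} → burningNumber-unique p E) (λ {p} {t} → burningNumber-at uniform {p} {t})
    (λ 1+t<k → burningNumber-< (here refl) (≤∣e∣ 1+t<k) v∉e)
    (λ t → burningNumber>0 v (suc t) , burningNumber≤n (suc t)) ,
  emptyIntervals (λ p → LazyBurningNumber p E) (λ t → lazyNumber (suc t)) 0<k
    (λ {p} → lazyNumber-unique p E) (λ {p} {t} → lazyNumber-at uniform {p} {t})
    (λ 1+t<k → lazyNumber-< (here refl) (≤∣e∣ 1+t<k))
    (λ t → lazyNumber>0 v t , lazyNumber≤n (suc t))
  where
  open Threshold E

  0<k : 0 < k
  0<k = subst (0 <_) ∣e∣≡k (ℕ.≤-trans (s≤s z≤n) 2≤∣e∣)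

  ≤∣e∣ : ∀ {t} → t ≤ k → t ≤ ∣ e ∣
  ≤∣e∣ = subst (_ ≤_) (sym ∣e∣≡k)

  outside-e = ≢∧∣≡∣⇒∃∉ e≢e′ (trans ∣e′∣≡k (sym ∣e∣≡k))
  v = proj₁ outside-e
  v∉e = proj₂ outside-e
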